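{- Let $\mathcal{O}$ be an order of conductor $\mathfrak{f}$ in an imaginary quadratic field, and let $\ell$ be a prime with $\ell \mid \mathfrak{f}$. Then the group $C_{\ell^2}(\mathcal{O}) = (\mathcal{O}/\ell^2\mathcal{O})^\times$, acting by multiplication on the elements of additive order $\ell^2$ in $\mathcal{O}/\ell^2\mathcal{O}$, has exactly $\ell + 1$ orbits: one of size $\ell^3(\ell-1)$ and $\ell$ of size $\ell(\ell-1)$. -}

module Defs where

open import Data.Nat as ℕ using (ℕ; zero; suc; NonZero)
open import Data.Nat.Properties using (m*n≢0)
open import Data.Nat.Primality using (Prime; prime⇒nonZero)
import Data.Nat.Divisibility as ℕD
open import Data.Integer as ℤ using (ℤ; +_; _%ℕ_; _/ℕ_)
open import Data.Integer.DivMod using (n%ℕd<d)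
open import Data.Fin using (Fin; fromℕ<; toℕ)
open import Data.Product using (Σ; ∃; ∃-syntax; _×_; _,_)
open import Data.List using (List; length)
open import Data.List.Membership.Propositional using (_∈_)
open import Data.List.Relation.Unary.Unique.Propositional using (Unique)
open import Function.Bundles using (_⇔_)
open import Relation.Binary.PropositionalEquality using (_≡_; _≢_)
open import Relation.Nullary using (¬_; yes; no)

SquareFree : ℤ → Set
SquareFree m = ∀ (k : ℕ) → (k ℕ.* k) ℕD.∣ ℤ.∣ m ∣ → k ≡ 1

-- The standard generator ω_K of the maximal order O_K = ℤ[ω_K]:
--   ω_K = (1 + √m)/2  if m ≡ 1 (mod 4),   ω_K = √m  otherwise.
-- traceω m = Tr(ω_K),  normω m = N(ω_K).
traceω : ℤ → ℤ
traceω m with m %ℕ 4 ℕ.≟ 1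
... | yes _ = + 1
... | no  _ = + 0

normω : ℤ → ℤ
normω m with m %ℕ 4 ℕ.≟ 1
... | yes _ = (+ 1 ℤ.- m) /ℕ 4     -- exact division, (1 - m)/4
... | no  _ = ℤ.- m

-- The order of conductor f in K is  O_f = ℤ + f O_K = ℤ[θ],  θ = f ω_K,
-- with θ² = t θ - n  where  t = Tr(θ) = f Tr(ω_K),  n = N(θ) = f² N(ω_K).
-- An element a + b θ of O_f is represented by the pair (a , b).
ordTrace : ℤ → ℕ → ℤ
ordTrace m f = + f ℤ.* traceω m

ordNorm : ℤ → ℕ → ℤ
ordNorm m f = + (f ℕ.* f) ℤ.* normω m

-- The quotient ring O/NO for O = ℤ[θ], θ² = tθ - n, as pairs of residues
-- (a mod N , b mod N) standing for a + bθ.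

module QuotRing (t n : ℤ) (N : ℕ) .{{_ : NonZero N}} where

  R : Set
  R = Fin N × Fin N

  red : ℤ → Fin N
  red z = fromℕ< (n%ℕd<d z N)

  emb : Fin N → ℤ
  emb i = + toℕ i

  0R : R
  0R = red (+ 0) , red (+ 0)

  1R : R
  1R = red (+ 1) , red (+ 0)

  _+R_ : R → R → R
  (a , b) +R (c , d) = red (emb a ℤ.+ emb c) , red (emb b ℤ.+ emb d)

  -- (a + bθ)(c + dθ) = (ac - bd n) + (ad + bc + bd t) θ
  _*R_ : R → R → R
  (a , b) *R (c , d) =
    red (emb a ℤ.* emb c ℤ.- emb b ℤ.* emb d ℤ.* n) ,
    red (emb a ℤ.* emb d ℤ.+ emb b ℤ.* emb c ℤ.+ emb b ℤ.* emb d ℤ.* t)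

  _·_ : ℕ → R → R
  zero  · x = 0R
  suc k · x = x +R (k · x)

  IsUnit : R → Set
  IsUnit u = ∃[ v ] (u *R v ≡ 1R)

  HasAddOrder : ℕ → R → Set
  HasAddOrder k x = (k · x ≡ 0R) × (∀ j → 0 ℕ.< j → j ℕ.< k → j · x ≢ 0R)

  InOrbit : R → R → Set
  InOrbit x y = ∃[ u ] (IsUnit u × u *R x ≡ y)

  HasSize : (R → Set) → ℕ → Set
  HasSize P k = Σ (List R) λ L → Unique L × length L ≡ k × (∀ y → (y ∈ L) ⇔ P y)

module ModSq (m : ℤ) (f ℓ : ℕ) (pℓ : Prime ℓ) where
  private
    instance
      nzℓ : NonZero ℓ
      nzℓ = prime⇒nonZero pℓ
      nzℓ² : NonZero (ℓ ℕ.* ℓ)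
      nzℓ² = m*n≢0 ℓ ℓ
  open QuotRing (ordTrace m f) (ordNorm m f) (ℓ ℕ.* ℓ) {{nzℓ²}} public

{-# OPTIONS --safe #-}

-- Write the order as ℤ[θ] with θ² = tθ − n; as ℓ divides the conductor, ℓ ∣ t and ℓ² ∣ n.
-- Modulo ℓ the norm a² + abt + b²n of a + bθ is a², so a + bθ is a unit of O/ℓ²O exactly when
-- ℓ ∤ a; the units form the orbit of 1, with ℓ(ℓ − 1) · ℓ² elements. For a unit u + vθ,
-- (u + vθ)(ℓk + θ) has θ-coefficient ≡ u (mod ℓ) and constant term ≡ uℓk (mod ℓ²), so the orbit
-- of ℓk + θ is {a + bθ : ℓ ∤ b, a ≡ bℓk (mod ℓ²)}, of size ℓ(ℓ − 1). An element of additive order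
-- ℓ² that is not a unit has ℓ ∣ a, hence ℓ ∤ b, and lies in the orbit with k ≡ (a/ℓ) b⁻¹ (mod ℓ).

module Submission where

module QuadraticOrderResidues where

  open import Data.Empty using (⊥-elim)
  open import Data.Fin as Fin using (Fin; toℕ; fromℕ<; combine; remQuot)
  open import Data.Fin.Properties
    using (toℕ-injective; toℕ<n; toℕ-fromℕ<; toℕ-combine; combine-remQuot; remQuot-combine; combine-injective; suc-injective)
  open import Data.Integer as ℤ using (ℤ; +_; 0ℤ; 1ℤ; _%ℕ_; _/ℕ_; _+_; _*_; _-_; -_)
  open import Data.Integer.DivMod using (n%ℕd<d; a≡a%ℕn+[a/ℕn]*n)
  open import Data.Integer.Divisibility.Signed
    using (_∣_; divides; _∣?_; ∣-refl; ∣-trans; ∣ᵤ⇒∣; ∣⇒∣ᵤ; ∣m∣n⇒∣m+n; ∣n⇒∣m*n; ∣m⇒∣m*n; ∣m⇒∣-m;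
           *-monoʳ-∣; *-monoˡ-∣; *-cancelˡ-∣)
  import Data.Integer.Properties as ℤ
  open import Data.Integer.Tactic.RingSolver using (solve-∀)
  open import Data.List using (tabulate)
  open import Data.List.Membership.Propositional using (_∈_)
  open import Data.List.Membership.Propositional.Properties using (∈-tabulate⁺; ∈-tabulate⁻)
  open import Data.List.Properties using (length-tabulate)
  open import Data.List.Relation.Unary.Unique.Propositional.Properties using (tabulate⁺)
  open import Data.Nat as ℕ using (ℕ; zero; suc; NonZero; _<_; _∸_; _^_; nonTrivial⇒≢1; nonTrivial⇒n>1)
  open import Data.Nat.Coprimality using (coprime-Bézout; prime⇒coprime)
  open import Data.Nat.GCD using (module Bézout)
  open import Data.Nat.Primality using (Prime; prime⇒nonTrivial; prime⇒nonZero; euclidsLemma)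
  import Data.Nat.Tactic.RingSolver as ℕ-Solver
  import Data.Nat.Divisibility as ℕ
  import Data.Nat.Properties as ℕ
  open import Data.Product using (∃; ∃-syntax; _×_; _,_; proj₁; proj₂; uncurry; map; map₁)
  open import Data.Sum using (_⊎_; inj₁; inj₂)
  open import Defs using (module QuotRing; traceω; normω; ordTrace; ordNorm)
  open import Function using (_∘_; id)
  open import Function.Bundles using (_⇔_; mk⇔; module Equivalence)
  open import Relation.Binary.PropositionalEquality
  open import Relation.Nullary using (¬_; yes; no)

  -- Congruences are proved by writing the difference as an explicit combination of
  -- known multiples of the modulus; the ring solver checks the polynomial identity.
  infixl 6 _⊕_
  infixl 7 _⊛_

  _⊕_ : ∀ {k p q} → k ∣ p → k ∣ q → k ∣ p + q
  _⊕_ = ∣m∣n⇒∣m+n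

  _⊛_ : ∀ {k p} a → k ∣ p → k ∣ a * p
  a ⊛ d = ∣n⇒∣m*n a d

  ⊝ : ∀ {k p} → k ∣ p → k ∣ - p
  ⊝ = ∣m⇒∣-m

  ∣-resp : ∀ {k p e} → k ∣ p → e ≡ p → k ∣ e
  ∣-resp {k} d e≡p = subst (k ∣_) (sym e≡p) d

  infix 4 _≡_mod_

  record _≡_mod_ (a b : ℤ) (K : ℕ) : Set where
    constructor mk≡mod
    field divides-diff : + K ∣ a - b

  open _≡_mod_ public

  ≡mod-by : ∀ {K p a b} → + K ∣ p → a - b ≡ p → a ≡ b mod K
  ≡mod-by d eq = mk≡mod (∣-resp d eq)

  ≡mod-sym : ∀ {K a b} → a ≡ b mod K → b ≡ a mod K
  ≡mod-sym {a = a} {b} d = ≡mod-by (⊝ (divides-diff d)) (identity a b)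
    where
    identity : ∀ a b → b - a ≡ - (a - b)
    identity = solve-∀

  ≡mod-trans : ∀ {K a b c} → a ≡ b mod K → b ≡ c mod K → a ≡ c mod K
  ≡mod-trans {a = a} {b} {c} d e = ≡mod-by (divides-diff d ⊕ divides-diff e) (identity a b c)
    where
    identity : ∀ a b c → a - c ≡ (a - b) + (b - c)
    identity = solve-∀

  %ℕ-≡mod : ∀ K .{{_ : NonZero K}} z → + (z %ℕ K) ≡ z mod K
  %ℕ-≡mod K z = mk≡mod (divides (- (z /ℕ K))
    (trans (cong (λ w → + (z %ℕ K) - w) (a≡a%ℕn+[a/ℕn]*n z K)) (identity (+ (z %ℕ K)) (z /ℕ K) (+ K))))
    where
    identity : ∀ r q k → r - (r + q * k) ≡ (- q) * k
    identity = solve-∀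

  fromℕ<-%ℕ-≡mod : ∀ K .{{_ : NonZero K}} z → + toℕ (fromℕ< (n%ℕd<d z K)) ≡ z mod K
  fromℕ<-%ℕ-≡mod K z = subst (λ w → + w ≡ z mod K) (sym (toℕ-fromℕ< (n%ℕd<d z K))) (%ℕ-≡mod K z)

  ∣-<⇒≡0 : ∀ {K m} → K ℕ.∣ m → m < K → m ≡ 0
  ∣-<⇒≡0 {m = zero}  _ _   = refl
  ∣-<⇒≡0 {m = suc _} d m<K = ⊥-elim (ℕ.>⇒∤ m<K d)

  ≡mod-<⇒≡ : ∀ {K p q} → p < K → q < K → + p ≡ + q mod K → p ≡ q
  ≡mod-<⇒≡ {K} {p} {q} p<K q<K d =
    ℤ.+-injective (ℤ.i-j≡0⇒i≡j (+ p) (+ q) (ℤ.∣i∣≡0⇒i≡0 (∣-<⇒≡0 (∣⇒∣ᵤ (divides-diff d)) ∣p-q∣<K)))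
    where
    ∣p-q∣<K : ℤ.∣ + p - + q ∣ < K
    ∣p-q∣<K = ℕ.≤-<-trans (subst (ℕ._≤ p ℕ.⊔ q) (cong ℤ.∣_∣ (sym (ℤ.m-n≡m⊖n p q))) (ℤ.∣m⊝n∣≤m⊔n p q))
                          (ℕ.⊔-lub p<K q<K)

  ∣²⇒∣ : ∀ {K z} → + (K ℕ.* K) ∣ z → + K ∣ z
  ∣²⇒∣ {K} = ∣-trans (divides (+ K) (ℤ.pos-* K K))

  ∣⇒∣²-*ˡ : ∀ {K z} → + K ∣ z → + (K ℕ.* K) ∣ + K * z
  ∣⇒∣²-*ˡ {K} {z} d = subst (_∣ + K * z) (sym (ℤ.pos-* K K)) (*-monoʳ-∣ (+ K) d)

  ∣²-*ˡ⇒∣ : ∀ {K z} .{{_ : NonZero K}} → + (K ℕ.* K) ∣ + K * z → + K ∣ z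
  ∣²-*ˡ⇒∣ {K} {z} d = *-cancelˡ-∣ (+ K) (subst (_∣ + K * z) (ℤ.pos-* K K) d)

  ∣⇒∣²-square : ∀ {K z} → + K ∣ z → + (K ℕ.* K) ∣ z * z
  ∣⇒∣²-square {K} {z} d = subst (_∣ z * z) (sym (ℤ.pos-* K K)) (∣-trans (*-monoʳ-∣ (+ K) d) (*-monoˡ-∣ z d))

  prime∤1 : ∀ {p} → Prime p → ¬ + p ∣ 1ℤ
  prime∤1 pp d = nonTrivial⇒≢1 {{prime⇒nonTrivial pp}} (ℕ.∣1⇒≡1 (∣⇒∣ᵤ d))

  prime∣square⇒∣ : ∀ {p z} → Prime p → + p ∣ z * z → + p ∣ z
  prime∣square⇒∣ {p} {z} pp d with euclidsLemma ℤ.∣ z ∣ ℤ.∣ z ∣ pp (subst (p ℕ.∣_) (ℤ.abs-* z z) (∣⇒∣ᵤ d))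
  ... | inj₁ p∣z = ∣ᵤ⇒∣ p∣z
  ... | inj₂ p∣z = ∣ᵤ⇒∣ p∣z

  ∃-inverse-mod-prime : ∀ {p} → Prime p → ∀ z → ¬ + p ∣ z → ∃[ w ] w * z ≡ 1ℤ mod p
  ∃-inverse-mod-prime {p} pp = inverse
    where
    instance
      p≢0 : NonZero p
      p≢0 = prime⇒nonZero pp
    inverse : ∀ z → ¬ + p ∣ z → ∃[ w ] w * z ≡ 1ℤ mod p
    inverse z p∤z with z %ℕ p in z%p≡r | %ℕ-≡mod p z
    ... | zero  | 0≡z = ⊥-elim (p∤z (∣-resp (⊝ (divides-diff 0≡z)) (identity z)))
      where
      identity : ∀ z → z ≡ - (0ℤ - z)
      identity = solve-∀
    ... | suc r | r≡z with inverse-of-r (coprime-Bézout (prime⇒coprime pp (subst (_< p) z%p≡r (n%ℕd<d z p))))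
      where
      ℕ-affine : ∀ a b c → + (a ℕ.+ b ℕ.* c) ≡ + a + + b * + c
      ℕ-affine a b c = trans (ℤ.pos-+ a (b ℕ.* c)) (cong (_+_ (+ a)) (ℤ.pos-* b c))
      inverse-of-r : Bézout.Identity 1 p (suc r) → ∃[ w ] w * + suc r ≡ 1ℤ mod p
      inverse-of-r (Bézout.+- x y eq) =
        - + y , ≡mod-by (⊝ (subst (+ p ∣_) (ℕ-affine 1 y (suc r)) (∣ᵤ⇒∣ (ℕ.divides x eq)))) (identity (+ y) (+ suc r))
        where
        identity : ∀ y r → (- y) * r - 1ℤ ≡ - (1ℤ + y * r)
        identity = solve-∀
      inverse-of-r (Bézout.-+ x y eq) = + y , ≡mod-by (+ x ⊛ ∣-refl) yr-1≡xp
        where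
        identity : ∀ a → 1ℤ + a - 1ℤ ≡ a
        identity = solve-∀
        yr-1≡xp : + y * + suc r - 1ℤ ≡ + x * + p
        yr-1≡xp = trans (cong (_- 1ℤ) (trans (sym (ℤ.pos-* y (suc r))) (trans (cong +_ (sym eq)) (ℕ-affine 1 x p))))
                        (identity (+ x * + p))
    ... | w , wr≡1 = w , ≡mod-trans (≡mod-by (w ⊛ divides-diff (≡mod-sym r≡z)) (identity w z (+ suc r))) wr≡1
      where
      identity : ∀ w z r → w * z - w * r ≡ w * (z - r)
      identity = solve-∀

  -- w ↦ w (2 - w z) is a Newton step: the error w z - 1 gets squared.
  inverse-mod-square : ∀ {K w z} → w * z ≡ 1ℤ mod K → w * (+ 2 - w * z) * z ≡ 1ℤ mod (K ℕ.* K)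
  inverse-mod-square {w = w} {z} wz≡1 = ≡mod-by (⊝ (∣⇒∣²-square (divides-diff wz≡1))) (identity w z)
    where
    identity : ∀ w z → w * (+ 2 - w * z) * z - 1ℤ ≡ - ((w * z - 1ℤ) * (w * z - 1ℤ))
    identity = solve-∀

  remQuot-injective : ∀ {a} b {i j : Fin (a ℕ.* b)} → remQuot {a} b i ≡ remQuot b j → i ≡ j
  remQuot-injective {a} b {i} {j} eq =
    trans (sym (combine-remQuot {a} b i)) (trans (cong (uncurry combine) eq) (combine-remQuot {a} b j))

  nonMultiple : ∀ {a} c → Fin (a ℕ.* c) → Fin (a ℕ.* suc c)
  nonMultiple {a} c i = combine (proj₁ (remQuot {a} c i)) (Fin.suc (proj₂ (remQuot {a} c i)))

  ∣combine⇒≡zero : ∀ {a c} (q : Fin a) (s : Fin (suc c)) → suc c ℕ.∣ toℕ (combine q s) → s ≡ Fin.zero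
  ∣combine⇒≡zero {c = c} q s d = toℕ-injective (∣-<⇒≡0 ∣s (toℕ<n s))
    where
    ∣s : suc c ℕ.∣ toℕ s
    ∣s = ℕ.∣m+n∣m⇒∣n (subst (suc c ℕ.∣_) (toℕ-combine q s) d) (ℕ.m∣m*n (toℕ q))

  nonMultiple-∤ : ∀ {a} c (i : Fin (a ℕ.* c)) → ¬ suc c ℕ.∣ toℕ (nonMultiple {a} c i)
  nonMultiple-∤ {a} c i d with ∣combine⇒≡zero (proj₁ (remQuot {a} c i)) (Fin.suc (proj₂ (remQuot {a} c i))) d
  ... | ()

  nonMultiple-injective : ∀ {a} c {i j : Fin (a ℕ.* c)} → nonMultiple {a} c i ≡ nonMultiple {a} c j → i ≡ j
  nonMultiple-injective {a} c {i} {j} eq with combine-injective (proj₁ (remQuot {a} c i)) _ (proj₁ (remQuot {a} c j)) _ eq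
  ... | q≡q′ , r≡r′ = remQuot-injective {a} c (cong₂ _,_ q≡q′ (suc-injective r≡r′))

  nonMultiple-surjective : ∀ {a} c (b : Fin (a ℕ.* suc c)) → ¬ suc c ℕ.∣ toℕ b →
                           ∃ λ i → nonMultiple {a} c i ≡ b
  nonMultiple-surjective {a} c b ∤b with remQuot {a} (suc c) b in eq
  ... | q , Fin.zero = ⊥-elim (∤b (subst (λ x → suc c ℕ.∣ toℕ x) b≡ ∣combine))
    where
    b≡ : combine q Fin.zero ≡ b
    b≡ = trans (cong (uncurry combine) (sym eq)) (combine-remQuot {a} (suc c) b)
    ∣combine : suc c ℕ.∣ toℕ (combine q Fin.zero)
    ∣combine = subst (suc c ℕ.∣_) (sym (toℕ-combine q Fin.zero)) (ℕ.∣m∣n⇒∣m+n (ℕ.m∣m*n (toℕ q)) (ℕ._∣0 _))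
  ... | q , Fin.suc r = combine q r ,
    trans (cong (λ p → combine (proj₁ p) (Fin.suc (proj₂ p))) (remQuot-combine {a} {c} q r))
          (trans (cong (uncurry combine) (sym eq)) (combine-remQuot {a} (suc c) b))

  module Residues (t n : ℤ) (N : ℕ) .{{_ : NonZero N}} where

    open QuotRing t n N public

    lift₀ lift₁ : R → ℤ
    lift₀ x = emb (proj₁ x)
    lift₁ x = emb (proj₂ x)

    emb-red : ∀ z → emb (red z) ≡ z mod N
    emb-red = fromℕ<-%ℕ-≡mod N

    emb-injective : ∀ {a b} → emb a ≡ emb b mod N → a ≡ b
    emb-injective {a} {b} = toℕ-injective ∘ ≡mod-<⇒≡ (toℕ<n a) (toℕ<n b)

    red-cong : ∀ {z w} → z ≡ w mod N → red z ≡ red w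
    red-cong {z} {w} d = emb-injective (≡mod-trans (emb-red z) (≡mod-trans d (≡mod-sym (emb-red w))))

    red-emb : ∀ a → red (emb a) ≡ a
    red-emb a = emb-injective (emb-red (emb a))

    lifts⇒≡ : ∀ {x y} → lift₀ x ≡ lift₀ y mod N → lift₁ x ≡ lift₁ y mod N → x ≡ y
    lifts⇒≡ d₀ d₁ = cong₂ _,_ (emb-injective d₀) (emb-injective d₁)

    lift₀-*R : ∀ x y → lift₀ (x *R y) ≡ lift₀ x * lift₀ y - lift₁ x * lift₁ y * n mod N
    lift₀-*R x y = emb-red _

    lift₁-*R : ∀ x y →
               lift₁ (x *R y) ≡ lift₀ x * lift₁ y + lift₁ x * lift₀ y + lift₁ x * lift₁ y * t mod N
    lift₁-*R x y = emb-red _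

    lifts-· : ∀ k x → lift₀ (k · x) ≡ + k * lift₀ x mod N × lift₁ (k · x) ≡ + k * lift₁ x mod N
    lifts-· zero    x = emb-red 0ℤ , emb-red 0ℤ
    lifts-· (suc k) x with lifts-· k x
    ... | d₀ , d₁ = step (emb-red _) d₀ , step (emb-red _) d₁
      where
      step : ∀ {s a e} → s ≡ a + e mod N → e ≡ + k * a mod N → s ≡ + suc k * a mod N
      step {s} {a} {e} d d′ = ≡mod-by (divides-diff d ⊕ divides-diff d′) (identity s a e (+ k))
        where
        identity : ∀ s a e k → s - (+ 1 + k) * a ≡ (s - (a + e)) + (e - k * a)
        identity = solve-∀

    ·≡0R⇔ : ∀ k x → k · x ≡ 0R ⇔ (+ k * lift₀ x ≡ 0ℤ mod N × + k * lift₁ x ≡ 0ℤ mod N)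
    ·≡0R⇔ k x = mk⇔
      (λ eq → ≡mod-trans (≡mod-sym (proj₁ (lifts-· k x))) (subst (λ y → lift₀ y ≡ 0ℤ mod N) (sym eq) (emb-red 0ℤ)) ,
              ≡mod-trans (≡mod-sym (proj₂ (lifts-· k x))) (subst (λ y → lift₁ y ≡ 0ℤ mod N) (sym eq) (emb-red 0ℤ)))
      (λ (d₀ , d₁) → lifts⇒≡ (≡mod-trans (proj₁ (lifts-· k x)) (≡mod-trans d₀ (≡mod-sym (emb-red 0ℤ))))
                             (≡mod-trans (proj₂ (lifts-· k x)) (≡mod-trans d₁ (≡mod-sym (emb-red 0ℤ)))))

    lift≡1⇒HasAddOrder : ∀ x → lift₀ x ≡ 1ℤ mod N ⊎ lift₁ x ≡ 1ℤ mod N → HasAddOrder N x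
    lift≡1⇒HasAddOrder x one = Equivalence.from (·≡0R⇔ N x) (multiple (lift₀ x) , multiple (lift₁ x)) ,
                        λ j 0<j j<N jx≡0 → ℕ.<⇒≢ 0<j (sym (≡mod-<⇒≡ j<N (ℕ.<-trans 0<j j<N)
                                                          (j≡0 j one (Equivalence.to (·≡0R⇔ j x) jx≡0))))
      where
      multiple : ∀ z → + N * z ≡ 0ℤ mod N
      multiple z = ≡mod-by (∣m⇒∣m*n z ∣-refl) (identity (+ N * z))
        where
        identity : ∀ a → a - 0ℤ ≡ a
        identity = solve-∀
      cancel : ∀ {j z} → + j * z ≡ 0ℤ mod N → z ≡ 1ℤ mod N → + j ≡ 0ℤ mod N
      cancel {j} {z} d e = ≡mod-by (divides-diff d ⊕ ⊝ (+ j ⊛ divides-diff e)) (identity (+ j) z)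
        where
        identity : ∀ j z → j - 0ℤ ≡ (j * z - 0ℤ) + - (j * (z - 1ℤ))
        identity = solve-∀
      j≡0 : ∀ j → lift₀ x ≡ 1ℤ mod N ⊎ lift₁ x ≡ 1ℤ mod N →
            + j * lift₀ x ≡ 0ℤ mod N × + j * lift₁ x ≡ 0ℤ mod N → + j ≡ 0ℤ mod N
      j≡0 j (inj₁ e) (d , _) = cancel d e
      j≡0 j (inj₂ e) (_ , d) = cancel d e

    *R-identityʳ : ∀ x → x *R 1R ≡ x
    *R-identityʳ x = lifts⇒≡
      (≡mod-trans (lift₀-*R x 1R) (≡mod-by (lift₀ x ⊛ o₀ ⊕ ⊝ ((lift₁ x * n) ⊛ o₁))
                                            (identity₀ (lift₀ x) (lift₁ x) n (lift₀ 1R) (lift₁ 1R))))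
      (≡mod-trans (lift₁-*R x 1R) (≡mod-by (lift₀ x ⊛ o₁ ⊕ lift₁ x ⊛ o₀ ⊕ (lift₁ x * t) ⊛ o₁)
                                            (identity₁ (lift₀ x) (lift₁ x) t (lift₀ 1R) (lift₁ 1R))))
      where
      o₀ : + N ∣ lift₀ 1R - 1ℤ
      o₀ = divides-diff (emb-red 1ℤ)
      o₁ : + N ∣ lift₁ 1R - 0ℤ
      o₁ = divides-diff (emb-red 0ℤ)
      identity₀ : ∀ a b n p q → (a * p - b * q * n) - a ≡ a * (p - 1ℤ) + - ((b * n) * (q - 0ℤ))
      identity₀ = solve-∀
      identity₁ : ∀ a b t p q → (a * q + b * p + b * q * t) - b ≡ a * (q - 0ℤ) + b * (p - 1ℤ) + (b * t) * (q - 0ℤ)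
      identity₁ = solve-∀

    InOrbit-1R⇔IsUnit : ∀ y → InOrbit 1R y ⇔ IsUnit y
    InOrbit-1R⇔IsUnit y = mk⇔
      (λ (u , u-unit , u≡y) → subst IsUnit (trans (sym (*R-identityʳ u)) u≡y) u-unit)
      (λ y-unit → y , y-unit , *R-identityʳ y)

    norm : R → ℤ
    norm x = lift₀ x * lift₀ x + lift₀ x * lift₁ x * t + lift₁ x * lift₁ x * n

    -- w times the conjugate (a + b t) - b θ of x = a + b θ
    scaledConjugate : ℤ → R → R
    scaledConjugate w x = red (w * (lift₀ x + lift₁ x * t)) , red (- (w * lift₁ x))

    *R-scaledConjugate : ∀ x {w} → w * norm x ≡ 1ℤ mod N → x *R scaledConjugate w x ≡ 1R
    *R-scaledConjugate x {w} inverse = lifts⇒≡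
      (≡mod-trans (lift₀-*R x v)
        (≡mod-by (a ⊛ v₀ ⊕ ⊝ ((b * n) ⊛ v₁) ⊕ divides-diff inverse ⊕ ⊝ o₀)
                 (identity₀ a b t n w (lift₀ v) (lift₁ v) (lift₀ 1R))))
      (≡mod-trans (lift₁-*R x v)
        (≡mod-by (a ⊛ v₁ ⊕ b ⊛ v₀ ⊕ (b * t) ⊛ v₁ ⊕ ⊝ o₁)
                 (identity₁ a b t w (lift₀ v) (lift₁ v) (lift₁ 1R))))
      where
      a b : ℤ
      a = lift₀ x
      b = lift₁ x
      v : R
      v = scaledConjugate w x
      v₀ : + N ∣ lift₀ v - w * (a + b * t)
      v₀ = divides-diff (emb-red (w * (a + b * t)))
      v₁ : + N ∣ lift₁ v - - (w * b)
      v₁ = divides-diff (emb-red (- (w * b)))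
      o₀ : + N ∣ lift₀ 1R - 1ℤ
      o₀ = divides-diff (emb-red 1ℤ)
      o₁ : + N ∣ lift₁ 1R - 0ℤ
      o₁ = divides-diff (emb-red 0ℤ)
      identity₀ : ∀ a b t n w p q o →
        (a * p - b * q * n) - o ≡
        a * (p - w * (a + b * t)) + - ((b * n) * (q - - (w * b))) + (w * (a * a + a * b * t + b * b * n) - 1ℤ) + - (o - 1ℤ)
      identity₀ = solve-∀
      identity₁ : ∀ a b t w p q o →
        (a * q + b * p + b * q * t) - o ≡
        a * (q - - (w * b)) + b * (p - w * (a + b * t)) + (b * t) * (q - - (w * b)) + - (o - 0ℤ)
      identity₁ = solve-∀

    hasSize-enumeration : ∀ {P : R → Set} K (g : Fin K → R) → (∀ {i j} → g i ≡ g j → i ≡ j) →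
                          (∀ i → P (g i)) → (∀ y → P y → ∃ λ i → g i ≡ y) → HasSize P K
    hasSize-enumeration {P} K g g-injective g-sound g-complete =
      tabulate g , tabulate⁺ g-injective , length-tabulate g ,
      λ y → mk⇔ (λ y∈ → let (i , gi≡y) = ∈-tabulate⁻ y∈ in subst P (sym gi≡y) (g-sound i))
                 (λ Py → let (i , gi≡y) = g-complete y Py in subst (_∈ tabulate g) gi≡y (∈-tabulate⁺ i))

  ℓ∣ordTrace : ∀ m {f ℓ} → ℓ ℕ.∣ f → + ℓ ∣ ordTrace m f
  ℓ∣ordTrace m {f} ℓ∣f = ∣m⇒∣m*n {m = + f} (traceω m) (∣ᵤ⇒∣ ℓ∣f)

  ℓ²∣ordNorm : ∀ m {f ℓ} → ℓ ℕ.∣ f → + (ℓ ℕ.* ℓ) ∣ ordNorm m f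
  ℓ²∣ordNorm m {f} ℓ∣f = ∣m⇒∣m*n {m = + (f ℕ.* f)} (normω m) (∣ᵤ⇒∣ (ℕ.*-pres-∣ ℓ∣f ℓ∣f))

  -- ℓ = suc c, so that ℓ ∸ 1 reduces to c.
  module Conductor (c : ℕ) (pℓ : Prime (suc c)) (t n : ℤ)
                   (ℓ∣t : + suc c ∣ t) (ℓ²∣n : + (suc c ℕ.* suc c) ∣ n) where

    ℓ : ℕ
    ℓ = suc c

    open Residues t n (ℓ ℕ.* ℓ) public

    ℓ<ℓ² : ℓ < ℓ ℕ.* ℓ
    ℓ<ℓ² = ℕ.m<m*n ℓ ℓ (nonTrivial⇒n>1 ℓ {{prime⇒nonTrivial pℓ}})

    ℓ∣n : + ℓ ∣ n
    ℓ∣n = ∣²⇒∣ ℓ²∣n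

    IsUnit⇒ℓ∤lift₀ : ∀ {u} → IsUnit u → ¬ + ℓ ∣ lift₀ u
    IsUnit⇒ℓ∤lift₀ {u} (v , uv≡1) ℓ∣a =
      prime∤1 pℓ (∣-resp (lift₀ v ⊛ ℓ∣a ⊕ ⊝ ((lift₁ u * lift₁ v) ⊛ ℓ∣n) ⊕ ⊝ (∣²⇒∣ (divides-diff product≡1)))
                  (identity (lift₀ u) (lift₀ v) (lift₁ u) (lift₁ v) n))
      where
      product≡1 : lift₀ u * lift₀ v - lift₁ u * lift₁ v * n ≡ 1ℤ mod (ℓ ℕ.* ℓ)
      product≡1 = ≡mod-trans (≡mod-sym (lift₀-*R u v)) (subst (λ y → lift₀ y ≡ 1ℤ mod (ℓ ℕ.* ℓ)) (sym uv≡1) (emb-red 1ℤ))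
      identity : ∀ a c b d n → 1ℤ ≡ c * a + - ((b * d) * n) + - ((a * c - b * d * n) - 1ℤ)
      identity = solve-∀

    ℓ∤lift₀⇒ℓ∤norm : ∀ {x} → ¬ + ℓ ∣ lift₀ x → ¬ + ℓ ∣ norm x
    ℓ∤lift₀⇒ℓ∤norm {x} ℓ∤a ℓ∣ν =
      ℓ∤a (prime∣square⇒∣ pℓ (∣-resp (ℓ∣ν ⊕ ⊝ ((lift₀ x * lift₁ x) ⊛ ℓ∣t) ⊕ ⊝ ((lift₁ x * lift₁ x) ⊛ ℓ∣n))
                             (identity (lift₀ x) (lift₁ x) t n)))
      where
      identity : ∀ a b t n → a * a ≡ (a * a + a * b * t + b * b * n) + - ((a * b) * t) + - ((b * b) * n)
      identity = solve-∀

    ℓ∤lift₀⇒IsUnit : ∀ {x} → ¬ + ℓ ∣ lift₀ x → IsUnit x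
    ℓ∤lift₀⇒IsUnit {x} ℓ∤a = scaledConjugate w x , *R-scaledConjugate x {w} (inverse-mod-square {ℓ} {proj₁ inverse} {norm x} (proj₂ inverse))
      where
      inverse : ∃[ w ] w * norm x ≡ 1ℤ mod ℓ
      inverse = ∃-inverse-mod-prime pℓ (norm x) (ℓ∤lift₀⇒ℓ∤norm ℓ∤a)
      w : ℤ
      w = proj₁ inverse * (+ 2 - proj₁ inverse * norm x)

    HasAddOrder-ℓ∣lift₀⇒ℓ∤lift₁ : ∀ {x} → HasAddOrder (ℓ ℕ.* ℓ) x → + ℓ ∣ lift₀ x → ¬ + ℓ ∣ lift₁ x
    HasAddOrder-ℓ∣lift₀⇒ℓ∤lift₁ {x} (_ , no-smaller-order) ℓ∣a ℓ∣b =
      no-smaller-order ℓ (ℕ.s≤s ℕ.z≤n) ℓ<ℓ² (Equivalence.from (·≡0R⇔ ℓ x) (ℓ·≡0 ℓ∣a , ℓ·≡0 ℓ∣b))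
      where
      identity : ∀ a → a - 0ℤ ≡ a
      identity = solve-∀
      ℓ·≡0 : ∀ {z} → + ℓ ∣ z → + ℓ * z ≡ 0ℤ mod (ℓ ℕ.* ℓ)
      ℓ·≡0 {z} d = ≡mod-by (∣⇒∣²-*ˡ d) (identity (+ ℓ * z))

    ρ : Fin ℓ → R
    ρ k = red (+ ℓ * + toℕ k) , red 1ℤ

    ℓ∣lift₀-ρ : ∀ k → + ℓ ∣ lift₀ (ρ k)
    ℓ∣lift₀-ρ k = ∣-resp (∣²⇒∣ (divides-diff (emb-red (+ ℓ * + toℕ k))) ⊕ ∣m⇒∣m*n (+ toℕ k) ∣-refl)
                         (identity (lift₀ (ρ k)) (+ ℓ) (+ toℕ k))
      where
      identity : ∀ e l k → e ≡ (e - l * k) + l * k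
      identity = solve-∀

    InOrbit-ρ⇒ : ∀ k {y} → InOrbit (ρ k) y →
                 ¬ + ℓ ∣ lift₁ y × lift₁ y * (+ ℓ * + toℕ k) ≡ lift₀ y mod (ℓ ℕ.* ℓ)
    InOrbit-ρ⇒ k (u , u-unit , refl) = ℓ∤y₁ , y₀≡
      where
      a b p q : ℤ
      a = lift₀ u
      b = lift₁ u
      p = lift₀ (ρ k)
      q = lift₁ (ρ k)
      y : R
      y = u *R ρ k
      y₁≡a : + ℓ ∣ lift₁ y - a
      y₁≡a = ∣-resp (∣²⇒∣ (divides-diff (lift₁-*R u (ρ k))) ⊕ a ⊛ ∣²⇒∣ (divides-diff (emb-red 1ℤ))
                     ⊕ b ⊛ ℓ∣lift₀-ρ k ⊕ (b * q) ⊛ ℓ∣t)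
                    (identity a b p q t (lift₁ y))
        where
        identity : ∀ a b p q t y → y - a ≡ (y - (a * q + b * p + b * q * t)) + a * (q - 1ℤ) + b * p + (b * q) * t
        identity = solve-∀
      ℓ∤y₁ : ¬ + ℓ ∣ lift₁ y
      ℓ∤y₁ ℓ∣y₁ = IsUnit⇒ℓ∤lift₀ {u} u-unit (∣-resp (ℓ∣y₁ ⊕ ⊝ y₁≡a) (identity (lift₁ y) a))
        where
        identity : ∀ y a → a ≡ y + - (y - a)
        identity = solve-∀
      y₀≡ : lift₁ y * (+ ℓ * + toℕ k) ≡ lift₀ y mod (ℓ ℕ.* ℓ)
      y₀≡ = ≡mod-by (+ toℕ k ⊛ ∣⇒∣²-*ˡ y₁≡a ⊕ ⊝ (a ⊛ divides-diff (emb-red (+ ℓ * + toℕ k)))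
                     ⊕ ⊝ (divides-diff (lift₀-*R u (ρ k))) ⊕ (b * q) ⊛ ℓ²∣n)
                    (identity a b p q n (lift₀ y) (lift₁ y) (+ ℓ) (+ toℕ k))
        where
        identity : ∀ a b p q n x y l k → y * (l * k) - x ≡
                   k * (l * (y - a)) + - (a * (p - l * k)) + - (x - (a * p - b * q * n)) + (b * q) * n
        identity = solve-∀

    ⇒InOrbit-ρ : ∀ k {y} → ¬ + ℓ ∣ lift₁ y → lift₁ y * (+ ℓ * + toℕ k) ≡ lift₀ y mod (ℓ ℕ.* ℓ) →
                 InOrbit (ρ k) y
    ⇒InOrbit-ρ k {y} ℓ∤y₁ y₀≡ = u , ℓ∤lift₀⇒IsUnit {u} ℓ∤y₁ , lifts⇒≡
      (≡mod-trans (lift₀-*R u (ρ k))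
        (≡mod-by (b ⊛ divides-diff (emb-red (+ ℓ * + toℕ k)) ⊕ divides-diff y₀≡ ⊕ ⊝ ((q * n) ⊛ z))
                 (identity₀ b (lift₁ u) p q n (lift₀ y) (+ ℓ * + toℕ k))))
      (≡mod-trans (lift₁-*R u (ρ k))
        (≡mod-by (b ⊛ divides-diff (emb-red 1ℤ) ⊕ p ⊛ z ⊕ (q * t) ⊛ z)
                 (identity₁ b (lift₁ u) p q t)))
      where
      u : R
      u = proj₂ y , red 0ℤ
      b p q : ℤ
      b = lift₁ y
      p = lift₀ (ρ k)
      q = lift₁ (ρ k)
      z : + (ℓ ℕ.* ℓ) ∣ lift₁ u - 0ℤ
      z = divides-diff (emb-red 0ℤ)
      identity₀ : ∀ b e p q n x l → (b * p - e * q * n) - x ≡ b * (p - l) + (b * l - x) + - ((q * n) * (e - 0ℤ))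
      identity₀ = solve-∀
      identity₁ : ∀ b e p q t → (b * q + e * p + e * q * t) - b ≡ b * (q - 1ℤ) + p * (e - 0ℤ) + (q * t) * (e - 0ℤ)
      identity₁ = solve-∀

    InOrbit-ρ⇒ℓ∣lift₀ : ∀ k {y} → InOrbit (ρ k) y → + ℓ ∣ lift₀ y
    InOrbit-ρ⇒ℓ∣lift₀ k {y} o =
      ∣-resp (lift₁ y ⊛ ∣m⇒∣m*n (+ toℕ k) ∣-refl ⊕ ⊝ (∣²⇒∣ (divides-diff (proj₂ (InOrbit-ρ⇒ k o)))))
             (identity (lift₀ y) (lift₁ y) (+ ℓ * + toℕ k))
      where
      identity : ∀ x y m → x ≡ y * m + - (y * m - x)
      identity = solve-∀

    rep : Fin (suc ℓ) → R
    rep Fin.zero    = 1R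
    rep (Fin.suc k) = ρ k

    rep-hasAddOrder : ∀ i → HasAddOrder (ℓ ℕ.* ℓ) (rep i)
    rep-hasAddOrder Fin.zero    = lift≡1⇒HasAddOrder 1R (inj₁ (emb-red 1ℤ))
    rep-hasAddOrder (Fin.suc k) = lift≡1⇒HasAddOrder (ρ k) (inj₂ (emb-red 1ℤ))

    rep-distinct : ∀ i j → InOrbit (rep i) (rep j) → i ≡ j
    rep-distinct Fin.zero Fin.zero _ = refl
    rep-distinct Fin.zero (Fin.suc k) o =
      ⊥-elim (IsUnit⇒ℓ∤lift₀ {ρ k} (Equivalence.to (InOrbit-1R⇔IsUnit (ρ k)) o) (ℓ∣lift₀-ρ k))
    rep-distinct (Fin.suc k) Fin.zero o =
      ⊥-elim (prime∤1 pℓ (∣-resp (InOrbit-ρ⇒ℓ∣lift₀ k o ⊕ ⊝ (∣²⇒∣ (divides-diff (emb-red 1ℤ)))) (identity (lift₀ 1R))))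
      where
      identity : ∀ e → 1ℤ ≡ e + - (e - 1ℤ)
      identity = solve-∀
    rep-distinct (Fin.suc k) (Fin.suc k′) o =
      cong Fin.suc (toℕ-injective (≡mod-<⇒≡ (toℕ<n k) (toℕ<n k′) (mk≡mod (∣²-*ˡ⇒∣ ℓk≡ℓk′))))
      where
      p q : ℤ
      p = lift₀ (ρ k′)
      q = lift₁ (ρ k′)
      ℓk≡ℓk′ : + (ℓ ℕ.* ℓ) ∣ + ℓ * (+ toℕ k - + toℕ k′)
      ℓk≡ℓk′ = ∣-resp (divides-diff (proj₂ (InOrbit-ρ⇒ k o)) ⊕ ⊝ ((+ ℓ * + toℕ k) ⊛ divides-diff (emb-red 1ℤ))
                       ⊕ divides-diff (emb-red (+ ℓ * + toℕ k′)))
                      (identity p q (+ ℓ) (+ toℕ k) (+ toℕ k′))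
        where
        identity : ∀ p q l k k′ → l * (k - k′) ≡ (q * (l * k) - p) + - ((l * k) * (q - 1ℤ)) + (p - l * k′)
        identity = solve-∀

    ℓ∣lift₀⇒InOrbit-ρ : ∀ {x} → + ℓ ∣ lift₀ x → ¬ + ℓ ∣ lift₁ x → ∃[ k ] InOrbit (ρ k) x
    ℓ∣lift₀⇒InOrbit-ρ {x} (divides α a≡αℓ) ℓ∤b = k , ⇒InOrbit-ρ k {x} ℓ∤b
      (≡mod-by (lift₁ x ⊛ ∣⇒∣²-*ˡ (divides-diff k≡αw) ⊕ α ⊛ ∣⇒∣²-*ˡ (divides-diff wb≡1))
               (trans (cong (_-_ (lift₁ x * (+ ℓ * + toℕ k))) a≡αℓ) (identity (lift₁ x) (+ ℓ) (+ toℕ k) α w)))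
      where
      inverse : ∃[ w ] w * lift₁ x ≡ 1ℤ mod ℓ
      inverse = ∃-inverse-mod-prime pℓ (lift₁ x) ℓ∤b
      w : ℤ
      w = proj₁ inverse
      wb≡1 : w * lift₁ x ≡ 1ℤ mod ℓ
      wb≡1 = proj₂ inverse
      k : Fin ℓ
      k = fromℕ< (n%ℕd<d (α * w) ℓ)
      k≡αw : + toℕ k ≡ α * w mod ℓ
      k≡αw = fromℕ<-%ℕ-≡mod ℓ (α * w)
      identity : ∀ b l k α w → b * (l * k) - α * l ≡ b * (l * (k - α * w)) + α * (l * (w * b - 1ℤ))
      identity = solve-∀

    rep-cover : ∀ x → HasAddOrder (ℓ ℕ.* ℓ) x → ∃[ i ] InOrbit (rep i) x
    rep-cover x x-order with + ℓ ∣? lift₀ x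
    ... | no ℓ∤a  = Fin.zero , Equivalence.from (InOrbit-1R⇔IsUnit x) (ℓ∤lift₀⇒IsUnit {x} ℓ∤a)
    ... | yes ℓ∣a = map Fin.suc id (ℓ∣lift₀⇒InOrbit-ρ {x} ℓ∣a (HasAddOrder-ℓ∣lift₀⇒ℓ∤lift₁ {x} x-order ℓ∣a))

    ℓ∤toℕ⇔ℓ∤emb : ∀ (a : Fin (ℓ ℕ.* ℓ)) → (¬ ℓ ℕ.∣ toℕ a) ⇔ (¬ + ℓ ∣ emb a)
    ℓ∤toℕ⇔ℓ∤emb a = mk⇔ (λ ℓ∤a ℓ∣a → ℓ∤a (∣⇒∣ᵤ ℓ∣a)) (λ ℓ∤a ℓ∣a → ℓ∤a (∣ᵤ⇒∣ ℓ∣a))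

    unitOrbit-size : HasSize (InOrbit 1R) (ℓ ^ 3 ℕ.* (ℓ ∸ 1))
    unitOrbit-size = subst (HasSize (InOrbit 1R)) (count ℓ c)
      (hasSize-enumeration _ g g-injective g-sound g-complete)
      where
      count : ∀ a b → a ℕ.* b ℕ.* (a ℕ.* a) ≡ a ℕ.* (a ℕ.* (a ℕ.* 1)) ℕ.* b
      count = ℕ-Solver.solve-∀
      g : Fin (ℓ ℕ.* c ℕ.* (ℓ ℕ.* ℓ)) → R
      g = map₁ (nonMultiple {ℓ} c) ∘ remQuot {ℓ ℕ.* c} (ℓ ℕ.* ℓ)
      g-injective : ∀ {i j} → g i ≡ g j → i ≡ j
      g-injective eq = remQuot-injective {ℓ ℕ.* c} (ℓ ℕ.* ℓ)
        (cong₂ _,_ (nonMultiple-injective {ℓ} c (cong proj₁ eq)) (cong proj₂ eq))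
      g-sound : ∀ i → InOrbit 1R (g i)
      g-sound i = Equivalence.from (InOrbit-1R⇔IsUnit (g i))
        (ℓ∤lift₀⇒IsUnit {g i} (Equivalence.to (ℓ∤toℕ⇔ℓ∤emb _) (nonMultiple-∤ {ℓ} c _)))
      g-complete : ∀ y → InOrbit 1R y → ∃ λ i → g i ≡ y
      g-complete (a , b) o = combine i b ,
        trans (cong (map₁ (nonMultiple {ℓ} c)) (remQuot-combine {ℓ ℕ.* c} i b)) (cong (_, b) i↦a)
        where
        ℓ∤a : ¬ ℓ ℕ.∣ toℕ a
        ℓ∤a = Equivalence.from (ℓ∤toℕ⇔ℓ∤emb a) (IsUnit⇒ℓ∤lift₀ {a , b} (Equivalence.to (InOrbit-1R⇔IsUnit (a , b)) o))
        i : Fin (ℓ ℕ.* c)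
        i = proj₁ (nonMultiple-surjective {ℓ} c a ℓ∤a)
        i↦a : nonMultiple {ℓ} c i ≡ a
        i↦a = proj₂ (nonMultiple-surjective {ℓ} c a ℓ∤a)

    ρOrbit-size : ∀ k → HasSize (InOrbit (ρ k)) (ℓ ℕ.* (ℓ ∸ 1))
    ρOrbit-size k = hasSize-enumeration _ g g-injective g-sound g-complete
      where
      ℓk : ℤ
      ℓk = + ℓ * + toℕ k
      g : Fin (ℓ ℕ.* c) → R
      g i = red (emb (nonMultiple {ℓ} c i) * ℓk) , nonMultiple {ℓ} c i
      g-injective : ∀ {i j} → g i ≡ g j → i ≡ j
      g-injective eq = nonMultiple-injective {ℓ} c (cong proj₂ eq)
      g-sound : ∀ i → InOrbit (ρ k) (g i)
      g-sound i = ⇒InOrbit-ρ k (Equivalence.to (ℓ∤toℕ⇔ℓ∤emb _) (nonMultiple-∤ {ℓ} c i)) (≡mod-sym (emb-red _))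
      g-complete : ∀ y → InOrbit (ρ k) y → ∃ λ i → g i ≡ y
      g-complete (a , b) o = i , cong₂ _,_ (trans (cong (λ e → red (emb e * ℓk)) i↦b) (trans (red-cong ba≡a) (red-emb a))) i↦b
        where
        ℓ∤b : ¬ + ℓ ∣ emb b
        ℓ∤b = proj₁ (InOrbit-ρ⇒ k {a , b} o)
        ba≡a : emb b * ℓk ≡ emb a mod (ℓ ℕ.* ℓ)
        ba≡a = proj₂ (InOrbit-ρ⇒ k {a , b} o)
        i : Fin (ℓ ℕ.* c)
        i = proj₁ (nonMultiple-surjective {ℓ} c b (Equivalence.from (ℓ∤toℕ⇔ℓ∤emb b) ℓ∤b))
        i↦b : nonMultiple {ℓ} c i ≡ b
        i↦b = proj₂ (nonMultiple-surjective {ℓ} c b (Equivalence.from (ℓ∤toℕ⇔ℓ∤emb b) ℓ∤b))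

    rep-orbit-size : ∀ i → i ≢ Fin.zero → HasSize (InOrbit (rep i)) (ℓ ℕ.* (ℓ ∸ 1))
    rep-orbit-size Fin.zero    i≢0 = ⊥-elim (i≢0 refl)
    rep-orbit-size (Fin.suc k) _   = ρOrbit-size k

open import Defs
open import Data.Nat as ℕ using (ℕ; zero; suc; _*_; _∸_; _^_; _≤_)
open import Data.Nat.Divisibility using (_∣_)
open import Data.Nat.Primality using (Prime)
open import Data.Integer as ℤ using (ℤ)
open import Data.Fin as Fin using (Fin)
open import Data.Product using (Σ; ∃-syntax; _×_; _,_)
open import Relation.Binary.PropositionalEquality using (_≡_; _≢_)

lemma8p2 : (m : ℤ) → m ℤ.< ℤ.0ℤ → SquareFree m →
           (f : ℕ) → 1 ≤ f → (ℓ : ℕ) → (pℓ : Prime ℓ) → ℓ ∣ f →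
           let open ModSq m f ℓ pℓ in
           Σ (Fin (suc ℓ) → R) λ r →
             (∀ i → HasAddOrder (ℓ * ℓ) (r i))
           × (∀ i j → InOrbit (r i) (r j) → i ≡ j)
           × (∀ x → HasAddOrder (ℓ * ℓ) x → ∃[ i ] InOrbit (r i) x)
           × HasSize (InOrbit (r Fin.zero)) (ℓ ^ 3 * (ℓ ∸ 1))
           × (∀ i → i ≢ Fin.zero → HasSize (InOrbit (r i)) (ℓ * (ℓ ∸ 1)))
lemma8p2 m _ _ f _ zero    () _
lemma8p2 m _ _ f _ (suc c) pℓ ℓ∣f =
  rep , rep-hasAddOrder , rep-distinct , rep-cover , unitOrbit-size , rep-orbit-size
  where
  open QuadraticOrderResidues
  open Conductor c pℓ (ordTrace m f) (ordNorm m f) (ℓ∣ordTrace m ℓ∣f) (ℓ²∣ordNorm m ℓ∣f)
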